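{- Let $T$ be a tree. Call the following operation a reduction step: choose vertices $a,y,u_0,u_1,w$ of the current tree such that $u_0,u_1,w$ are leaves, $y$ has exactly the three neighbours $u_0,u_1,a$, and $w$ is adjacent to $a$; then delete $u_0,u_1,y,w$ (keeping $a$). Then $T$ has an eigenvector for eigenvalue $1$ with all entries in $\{1,-1\}$ if and only if $T$ can be reduced to the complete graph $K_2$ by a finite sequence of reduction steps.
   Context: Eigenvalues and eigenvectors of a graph are those of its adjacency matrix; an eigenvector is a non-zero vector $x$ indexed by the vertices with $Ax=\lambda x$. -}

module Defs where

open import Data.Nat using (ℕ; zero; suc; _≤_)
open import Data.Fin using (Fin; zero; suc)
open import Data.Fin.Properties using (_≟_)
open import Data.Bool using (Bool; true; false; _∧_; not; if_then_else_)
open import Data.Integer using (ℤ; _+_; _*_; 0ℤ; 1ℤ; -1ℤ)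
open import Data.List using (List; []; _∷_; _∷ʳ_; length)
open import Data.List.Relation.Unary.Linked using (Linked)
open import Data.List.Relation.Unary.Unique.Propositional using (Unique)
open import Data.Product using (Σ; ∃; _×_; _,_)
open import Data.Sum using (_⊎_)
open import Relation.Nullary using (¬_; does)
open import Relation.Binary.PropositionalEquality using (_≡_; _≢_)

record Graph (n : ℕ) : Set where
  field
    adj    : Fin n → Fin n → Bool
    sym    : ∀ u v → adj u v ≡ adj v u
    irrefl : ∀ v → adj v v ≡ false

open Graph public

Adj : ∀ {n} → Graph n → Fin n → Fin n → Set
Adj G u v = adj G u v ≡ true

data Walk {n} (G : Graph n) : Fin n → Fin n → Set where
  here  : ∀ v → Walk G v v
  there : ∀ {u v w} → Adj G u v → Walk G v w → Walk G u w

Connected : ∀ {n} → Graph n → Set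
Connected G = ∀ u v → Walk G u v

-- A cycle: distinct vertices v, x₁, …, xₖ, z (k ≥ 1, so length ≥ 3),
-- consecutive ones adjacent, and z adjacent to v.
HasCycle : ∀ {n} → Graph n → Set
HasCycle {n} G =
  Σ (Fin n) λ v → Σ (Fin n) λ z → Σ (List (Fin n)) λ xs →
    (1 ≤ length xs) × Linked (Adj G) (v ∷ xs ∷ʳ z) ×
    Unique (v ∷ xs ∷ʳ z) × Adj G z v

-- A tree: a nonempty connected acyclic graph.
IsTree : ∀ {n} → Graph n → Set
IsTree {n} G = Fin n × Connected G × ¬ HasCycle G

sumFin : ∀ {n} → (Fin n → ℤ) → ℤ
sumFin {zero}  f = 0ℤ
sumFin {suc n} f = f zero + sumFin (λ i → f (suc i))

adjMatrix : ∀ {n} → Graph n → Fin n → Fin n → ℤ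
adjMatrix G i j = if adj G i j then 1ℤ else 0ℤ

mulVec : ∀ {n} → (Fin n → Fin n → ℤ) → (Fin n → ℤ) → Fin n → ℤ
mulVec A x i = sumFin (λ j → A i j * x j)

IsEigenvector : ∀ {n} → Graph n → ℤ → (Fin n → ℤ) → Set
IsEigenvector {n} G λ′ x =
  (Σ (Fin n) λ v → x v ≢ 0ℤ) × (∀ v → mulVec (adjMatrix G) x v ≡ λ′ * x v)

SignVector : ∀ {n} → (Fin n → ℤ) → Set
SignVector x = ∀ v → (x v ≡ 1ℤ) ⊎ (x v ≡ -1ℤ)

-- Reductions. The current tree is the subgraph of G induced on a vertex set
-- S : Fin n → Bool (vertices v with S v ≡ true).
VSet : ℕ → Set
VSet n = Fin n → Bool

In : ∀ {n} → VSet n → Fin n → Set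
In S v = S v ≡ true

IsLeaf : ∀ {n} → Graph n → VSet n → Fin n → Set
IsLeaf {n} G S v = In S v ×
  (Σ (Fin n) λ u → In S u × Adj G v u × (∀ u′ → In S u′ → Adj G v u′ → u′ ≡ u))

IsReductionStep : ∀ {n} → Graph n → VSet n → (a y u₀ u₁ w : Fin n) → Set
IsReductionStep G S a y u₀ u₁ w =
  In S a × In S y ×
  IsLeaf G S u₀ × IsLeaf G S u₁ × IsLeaf G S w ×
  u₀ ≢ u₁ × u₀ ≢ a × u₁ ≢ a ×
  Adj G y u₀ × Adj G y u₁ × Adj G y a ×
  (∀ z → In S z → Adj G y z → (z ≡ u₀) ⊎ (z ≡ u₁) ⊎ (z ≡ a)) ×
  Adj G w a

delete4 : ∀ {n} → VSet n → (y u₀ u₁ w : Fin n) → VSet n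
delete4 S y u₀ u₁ w z =
  S z ∧ not (does (z ≟ u₀)) ∧ not (does (z ≟ u₁)) ∧ not (does (z ≟ y)) ∧ not (does (z ≟ w))

IsK2 : ∀ {n} → Graph n → VSet n → Set
IsK2 {n} G S = Σ (Fin n) λ p → Σ (Fin n) λ q →
  In S p × In S q × Adj G p q × (∀ z → In S z → (z ≡ p) ⊎ (z ≡ q))

data ReducesToK2 {n} (G : Graph n) : VSet n → Set where
  done : ∀ {S} → IsK2 G S → ReducesToK2 G S
  step : ∀ {S} (a y u₀ u₁ w : Fin n) → IsReductionStep G S a y u₀ u₁ w →
         ReducesToK2 G (delete4 S y u₀ u₁ w) → ReducesToK2 G S

allV : ∀ {n} → VSet n
allV _ = true

-- A sign vector x with A x = x is constant across every leaf edge. Reduction steps transport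
-- such vectors both ways: restricted to the smaller tree, x still satisfies the eigenvalue
-- equation, because the equation at y forces x y = - x a, which cancels against x w = x a in
-- the equation at a; conversely, an eigenvector of the smaller tree extends by x w = x a and
-- x u₀ = x u₁ = x y = - x a. As K₂ carries the all-ones vector, reducible trees have a sign
-- eigenvector. Conversely, prolong a path v₀ v₁ v₂ … at its v₀-end for as long as possible.
-- Then every neighbour of v₁ but v₂ is a leaf, and the equation at v₁ forces exactly two of
-- them; every neighbour of v₂ off the path is a leaf or such a star centre, with value - x v₂,
-- and the equation at v₂ rules out the second option for all of them. This is a reduction
-- step at a = v₂, and the reduced tree inherits connectivity and the eigenvector.

module Submission where

open import Defs
open import Data.Bool using (true; false; _∧_; not; if_then_else_)
import Data.Bool.Properties as Bool
open import Data.Empty using (⊥-elim)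
open import Data.Unit using (⊤; tt)
open import Data.Fin using (Fin; zero; suc)
import Data.Fin.Properties as FinP
open FinP using (_≟_; any?; pigeonhole)
open import Data.Integer using (ℤ; _+_; _*_; -_; +_; 0ℤ; 1ℤ; -1ℤ)
import Data.Integer.Properties as ℤ
open import Algebra.Properties.CommutativeSemigroup ℤ.+-commutativeSemigroup using (x∙yz≈y∙xz)
open import Algebra.Properties.AbelianGroup ℤ.+-0-abelianGroup using (\\-leftDividesʳ; inverseʳ-unique)
open import Data.Nat as ℕ using (ℕ; zero; suc; _≤_; _<_; z≤n; s≤s)
import Data.Nat.Properties as ℕ
open import Data.List using (List; []; _∷_; _++_; _∷ʳ_; [_]; length; lookup)
open import Data.List.Membership.Propositional using (_∉_)
open import Data.List.Membership.Propositional.Properties using (∈-lookup; ∈-∃++)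
open import Data.List.Relation.Unary.All as All using (All; []; _∷_)
open import Data.List.Relation.Unary.All.Properties using (¬Any⇒All¬) renaming (++⁻ˡ to All-++⁻ˡ)
open import Data.List.Relation.Unary.Any using (here; there)
open import Data.List.Properties using (++-assoc)
open import Data.List.Relation.Unary.AllPairs using (AllPairs; []; _∷_)
open import Data.List.Relation.Unary.Linked as Linked using (Linked; []; [-]; _∷_)
open import Data.List.Relation.Unary.Unique.Propositional using (Unique)
open import Data.Product using (Σ; ∃; _×_; _,_; proj₁; proj₂)
open import Data.Sum using (_⊎_; inj₁; inj₂)
open import Relation.Nullary using (¬_; Dec; does; yes; no; ¬?)
open import Relation.Nullary.Decidable using (_×-dec_; dec-true; dec-false)
open import Function.Bundles using (_⇔_; mk⇔)
import Relation.Binary.PropositionalEquality as ≡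
open ≡ using (_≡_; _≢_; ≢-sym; refl; trans; cong; cong₂; subst; module ≡-Reasoning)

sumOver : ∀ {n} → VSet n → (Fin n → ℤ) → ℤ
sumOver S g = sumFin (λ z → if S z then g z else 0ℤ)

count : ∀ {n} → VSet n → ℕ
count {zero}  S = 0
count {suc n} S = (if S zero then 1 else 0) ℕ.+ count (λ i → S (suc i))

-- The test on z comes first so that remove S v z reduces to S z once z ≟ v is decided.
remove : ∀ {n} → VSet n → Fin n → VSet n
remove S v z = not (does (z ≟ v)) ∧ S z

∧-≡true⁺ : ∀ {a b} → a ≡ true → b ≡ true → a ∧ b ≡ true
∧-≡true⁺ refl refl = refl

∧-≡true⁻ : ∀ a {b} → a ∧ b ≡ true → a ≡ true × b ≡ true
∧-≡true⁻ true eq = refl , eq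

≡true-ext : ∀ {a b} → (a ≡ true → b ≡ true) → (b ≡ true → a ≡ true) → a ≡ b
≡true-ext {false} {false} _ _ = refl
≡true-ext {false} {true}  _ g = g refl
≡true-ext {true}  {b}     f _ = ≡.sym (f refl)

does≡true⇒ : ∀ {A : Set} (a? : Dec A) → does a? ≡ true → A
does≡true⇒ (yes a) _ = a

∈-remove⁺ : ∀ {n} (S : VSet n) {v z} → In S z → z ≢ v → In (remove S v) z
∈-remove⁺ S {v} {z} z∈S z≢v with z ≟ v
... | yes z≡v = ⊥-elim (z≢v z≡v)
... | no _    = z∈S

∈-remove⁻ : ∀ {n} (S : VSet n) {v z} → In (remove S v) z → In S z × z ≢ v
∈-remove⁻ S {v} {z} z∈S-v with z ≟ v
... | no z≢v = z∈S-v , z≢v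

sumFin-cong : ∀ {n} {f g : Fin n → ℤ} → (∀ i → f i ≡ g i) → sumFin f ≡ sumFin g
sumFin-cong {zero}  eq = refl
sumFin-cong {suc n} eq = cong₂ _+_ (eq zero) (sumFin-cong (λ i → eq (suc i)))

if-cong : ∀ {b b′} {u u′ : ℤ} → b ≡ b′ → (b ≡ true → u ≡ u′) →
          (if b then u else 0ℤ) ≡ (if b′ then u′ else 0ℤ)
if-cong {true}  refl eq = eq refl
if-cong {false} refl _  = refl

sumOver-cong : ∀ {n} {S S′ : VSet n} {g g′ : Fin n → ℤ} →
               (∀ z → In S z → In S′ z) → (∀ z → In S′ z → In S z) →
               (∀ z → In S z → g z ≡ g′ z) → sumOver S g ≡ sumOver S′ g′
sumOver-cong S⊆S′ S′⊆S eq = sumFin-cong λ z → if-cong (≡true-ext (S⊆S′ z) (S′⊆S z)) (eq z)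

sumOver-remove : ∀ {n} (S : VSet n) g {v} → In S v → sumOver S g ≡ g v + sumOver (remove S v) g
sumOver-remove {suc n} S g {zero} v∈S rewrite v∈S = cong (λ t → g zero + t) (≡.sym (ℤ.+-identityˡ _))
sumOver-remove {suc n} S g {suc v} v∈S
  rewrite sumOver-remove (λ i → S (suc i)) (λ i → g (suc i)) v∈S
  = x∙yz≈y∙xz (if S zero then g zero else 0ℤ) (g (suc v)) _

count-remove : ∀ {n} (S : VSet n) {v} → In S v → count S ≡ suc (count (remove S v))
count-remove {suc n} S {zero}  v∈S rewrite v∈S = refl
count-remove {suc n} S {suc v} v∈S rewrite count-remove (λ i → S (suc i)) v∈S = ℕ.+-suc _ _

sumOver-empty : ∀ {n} (S : VSet n) g → (∀ z → S z ≡ false) → sumOver S g ≡ 0ℤ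
sumOver-empty {zero}  S g empty = refl
sumOver-empty {suc n} S g empty rewrite empty zero =
  trans (ℤ.+-identityˡ _) (sumOver-empty (λ i → S (suc i)) (λ i → g (suc i)) (λ i → empty (suc i)))

sumOver-const : ∀ {n} (S : VSet n) g c → (∀ z → In S z → g z ≡ c) → sumOver S g ≡ + count S * c
sumOver-const {zero}  S g c const = refl
sumOver-const {suc n} S g c const with S zero in e
... | true  = begin
  g zero + sumOver S′ (λ i → g (suc i))  ≡⟨ cong₂ _+_ (const zero e) (sumOver-const S′ _ c (λ i → const (suc i))) ⟩
  c + + count S′ * c                     ≡⟨ ≡.sym (ℤ.suc-* (+ count S′) c) ⟩
  + suc (count S′) * c                   ∎
  where
  open ≡-Reasoning
  S′ = λ i → S (suc i)
... | false = trans (ℤ.+-identityˡ _) (sumOver-const (λ i → S (suc i)) _ c (λ i → const (suc i)))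

count≡0⇒empty : ∀ {n} (S : VSet n) → count S ≡ 0 → ∀ z → S z ≡ false
count≡0⇒empty S count≡0 z with S z in z∈S
... | false = refl
... | true with () ← trans (≡.sym count≡0) (count-remove S z∈S)

count≢0⇒nonempty : ∀ {n} (S : VSet n) → count S ≢ 0 → ∃ (In S)
count≢0⇒nonempty {zero}  S count≢0 = ⊥-elim (count≢0 refl)
count≢0⇒nonempty {suc n} S count≢0 with S zero in e
... | true  = zero , e
... | false with count≢0⇒nonempty (λ i → S (suc i)) count≢0
...   | z , z∈S = suc z , z∈S

count≤n : ∀ {n} (S : VSet n) → count S ≤ n
count≤n {zero}  S = z≤n
count≤n {suc n} S with S zero
... | true  = s≤s (count≤n (λ i → S (suc i)))
... | false = ℕ.m≤n⇒m≤1+n (count≤n (λ i → S (suc i)))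

count-mono : ∀ {n} (S S′ : VSet n) → (∀ z → In S z → In S′ z) → count S ≤ count S′
count-mono {zero}  S S′ S⊆S′ = z≤n
count-mono {suc n} S S′ S⊆S′ with S zero in e | S′ zero in e′
... | true  | true  = s≤s (count-mono _ _ (λ i → S⊆S′ (suc i)))
... | false | true  = ℕ.m≤n⇒m≤1+n (count-mono _ _ (λ i → S⊆S′ (suc i)))
... | false | false = count-mono _ _ (λ i → S⊆S′ (suc i))
... | true  | false with () ← trans (≡.sym e′) (S⊆S′ zero e)

count≡1⇒singleton : ∀ {n} (S : VSet n) → count S ≡ 1 → ∃ λ u → In S u × ∀ z → In S z → z ≡ u
count≡1⇒singleton S count≡1 with count≢0⇒nonempty S (λ eq → ℕ.1+n≢0 (trans (≡.sym count≡1) eq))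
... | u , u∈S = u , u∈S , λ z z∈S → only z z∈S
  where
  only : ∀ z → In S z → z ≡ u
  only z z∈S with z ≟ u
  ... | yes z≡u = z≡u
  ... | no z≢u with () ← trans (≡.sym (count≡0⇒empty (remove S u)
                          (ℕ.suc-injective (trans (≡.sym (count-remove S u∈S)) count≡1)) z))
                          (∈-remove⁺ S z∈S z≢u)

count≡2⇒pair : ∀ {n} (S : VSet n) {p} → count S ≡ 2 → In S p →
               ∃ λ q → In S q × q ≢ p × ∀ z → In S z → z ≡ p ⊎ z ≡ q
count≡2⇒pair S {p} count≡2 p∈S
  with q , q∈S-p , only ← count≡1⇒singleton (remove S p) (ℕ.suc-injective (trans (≡.sym (count-remove S p∈S)) count≡2))
  = let q∈S , q≢p = ∈-remove⁻ S q∈S-p in q , q∈S , q≢p , p-or-q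
  where
  p-or-q : ∀ z → In S z → z ≡ p ⊎ z ≡ q
  p-or-q z z∈S with z ≟ p
  ... | yes z≡p = inj₁ z≡p
  ... | no z≢p  = inj₂ (only z (∈-remove⁺ S z∈S z≢p))

sumOver-singleton : ∀ {n} (S : VSet n) g {u} → In S u → (∀ z → In S z → z ≡ u) → sumOver S g ≡ g u
sumOver-singleton S g {u} u∈S only = begin
  sumOver S g                       ≡⟨ sumOver-remove S g u∈S ⟩
  g u + sumOver (remove S u) g      ≡⟨ cong (λ t → g u + t) (sumOver-empty _ g empty) ⟩
  g u + 0ℤ                          ≡⟨ ℤ.+-identityʳ _ ⟩
  g u                               ∎
  where
  open ≡-Reasoning
  empty : ∀ z → remove S u z ≡ false
  empty z with remove S u z in e
  ... | false = refl
  ... | true  = let z∈S , z≢u = ∈-remove⁻ S e in ⊥-elim (z≢u (only z z∈S))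

sumOver-three : ∀ {n} (S : VSet n) g {p q r} → In S p → In S q → In S r →
                p ≢ q → p ≢ r → q ≢ r → (∀ z → In S z → z ≡ p ⊎ z ≡ q ⊎ z ≡ r) →
                sumOver S g ≡ g p + (g q + g r)
sumOver-three S g {p} {q} {r} p∈S q∈S r∈S p≢q p≢r q≢r only = begin
  sumOver S g                                   ≡⟨ sumOver-remove S g p∈S ⟩
  g p + sumOver S-p g                           ≡⟨ cong (λ t → g p + t) (sumOver-remove S-p g q∈S-p) ⟩
  g p + (g q + sumOver (remove S-p q) g)        ≡⟨ cong (λ t → g p + (g q + t)) (sumOver-singleton _ g r∈S-p-q only-r) ⟩
  g p + (g q + g r)                             ∎
  where
  open ≡-Reasoning
  S-p = remove S p
  q∈S-p = ∈-remove⁺ S q∈S (λ q≡p → p≢q (≡.sym q≡p))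
  r∈S-p-q = ∈-remove⁺ S-p (∈-remove⁺ S r∈S (λ r≡p → p≢r (≡.sym r≡p))) (λ r≡q → q≢r (≡.sym r≡q))
  only-r : ∀ z → In (remove S-p q) z → z ≡ r
  only-r z z∈ with ∈-remove⁻ S-p z∈
  ... | z∈S-p , z≢q with ∈-remove⁻ S z∈S-p
  ...   | z∈S , z≢p with only z z∈S
  ...     | inj₁ z≡p        = ⊥-elim (z≢p z≡p)
  ...     | inj₂ (inj₁ z≡q) = ⊥-elim (z≢q z≡q)
  ...     | inj₂ (inj₂ z≡r) = z≡r

IsSign : ℤ → Set
IsSign t = t ≡ 1ℤ ⊎ t ≡ -1ℤ

if-preserves : ∀ {A : Set} {P : A → Set} b {u v} → P u → P v → P (if b then u else v)
if-preserves true  pu _  = pu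
if-preserves false _  pv = pv

sign≢0 : ∀ {t} → IsSign t → t ≢ 0ℤ
sign≢0 (inj₁ refl) ()
sign≢0 (inj₂ refl) ()

-‿sign : ∀ {t} → IsSign t → IsSign (- t)
-‿sign (inj₁ refl) = inj₂ refl
-‿sign (inj₂ refl) = inj₁ refl

-- The eigenvalue equation at a vertex s whose k neighbours other than p all carry the value s.
sign-star : ∀ k {s p} → IsSign s → IsSign p → s ≡ p + + k * s → k ≡ 0 ⊎ (k ≡ 2 × s ≡ - p)
sign-star k (inj₁ refl) (inj₁ refl) eq rewrite ℤ.*-identityʳ (+ k) with k | eq
... | zero  | _  = inj₁ refl
... | suc _ | ()
sign-star k (inj₁ refl) (inj₂ refl) eq rewrite ℤ.*-identityʳ (+ k) with k | eq
... | zero             | _  = inj₁ refl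
... | 1                | ()
... | 2                | _  = inj₂ (refl , refl)
... | suc (suc (suc _)) | ()
sign-star k (inj₂ refl) (inj₁ refl) eq rewrite ℤ.*-comm (+ k) -1ℤ | ℤ.-1*i≡-i (+ k) with k | eq
... | zero             | _  = inj₁ refl
... | 1                | ()
... | 2                | _  = inj₂ (refl , refl)
... | suc (suc (suc _)) | ()
sign-star k (inj₂ refl) (inj₂ refl) eq rewrite ℤ.*-comm (+ k) -1ℤ | ℤ.-1*i≡-i (+ k) with k | eq
... | zero  | _  = inj₁ refl
... | suc _ | ()

sign≢r+multiple : ∀ k {t r} → IsSign t → r ≡ 0ℤ ⊎ IsSign r → t ≢ r + + suc k * - t
sign≢r+multiple k       (inj₁ refl) (inj₁ refl)        ()
sign≢r+multiple k       (inj₂ refl) (inj₁ refl)        ()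
sign≢r+multiple zero    (inj₁ refl) (inj₂ (inj₁ refl)) ()
sign≢r+multiple (suc _) (inj₁ refl) (inj₂ (inj₁ refl)) ()
sign≢r+multiple k       (inj₁ refl) (inj₂ (inj₂ refl)) ()
sign≢r+multiple k       (inj₂ refl) (inj₂ (inj₁ refl)) ()
sign≢r+multiple zero    (inj₂ refl) (inj₂ (inj₂ refl)) ()
sign≢r+multiple (suc _) (inj₂ refl) (inj₂ (inj₂ refl)) ()

t≡t+[t+s]⇒t≡-s : ∀ t s → t ≡ t + (t + s) → t ≡ - s
t≡t+[t+s]⇒t≡-s t s eq = inverseʳ-unique s t (begin
  s + t                ≡⟨ ℤ.+-comm s t ⟩
  t + s                ≡⟨ ≡.sym (\\-leftDividesʳ t (t + s)) ⟩
  - t + (t + (t + s))  ≡⟨ cong (λ u → - t + u) (≡.sym eq) ⟩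
  - t + t              ≡⟨ ℤ.+-inverseˡ t ⟩
  0ℤ                   ∎)
  where open ≡-Reasoning

Linked-++⁻ˡ : ∀ {A : Set} {R : A → A → Set} xs {ys} → Linked R (xs ++ ys) → Linked R xs
Linked-++⁻ˡ []           _       = []
Linked-++⁻ˡ (x ∷ [])     _       = [-]
Linked-++⁻ˡ (x ∷ y ∷ xs) (r ∷ l) = r ∷ Linked-++⁻ˡ (y ∷ xs) l

AllPairs-++⁻ˡ : ∀ {A : Set} {R : A → A → Set} xs {ys} → AllPairs R (xs ++ ys) → AllPairs R xs
AllPairs-++⁻ˡ []       _          = []
AllPairs-++⁻ˡ (x ∷ xs) (px ∷ pxs) = All-++⁻ˡ xs px ∷ AllPairs-++⁻ˡ xs pxs

Unique-lookup-injective : ∀ {A : Set} {xs : List A} → Unique xs → ∀ i j → lookup xs i ≡ lookup xs j → i ≡ j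
Unique-lookup-injective (px ∷ _)   zero    zero    _  = refl
Unique-lookup-injective (px ∷ _)   zero    (suc j) eq = ⊥-elim (All.lookup px (∈-lookup j) eq)
Unique-lookup-injective (px ∷ _)   (suc i) zero    eq = ⊥-elim (All.lookup px (∈-lookup i) (≡.sym eq))
Unique-lookup-injective (_ ∷ pxs) (suc i) (suc j) eq = cong suc (Unique-lookup-injective pxs i j eq)

Unique⇒length≤ : ∀ {n} {xs : List (Fin n)} → Unique xs → length xs ≤ n
Unique⇒length≤ {n} {xs} unique with length xs ℕ.≤? n
... | yes length≤n = length≤n
... | no length≰n with i , j , i<j , eq ← pigeonhole (ℕ.≰⇒> length≰n) (lookup xs) =
  ⊥-elim (FinP.<⇒≢ i<j (Unique-lookup-injective unique i j eq))

bounded-ascent : ∀ {A B : Set} (size : A → ℕ) (m : ℕ) → (∀ a → size a ≤ m) →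
                 (∀ a → B ⊎ Σ A (λ a′ → size a < size a′)) → A → B
bounded-ascent {B = B} size m bounded grow a = ascend (suc m) a (s≤s (ℕ.m≤m+n m (size a)))
  where
  ascend : ∀ k a → m < k ℕ.+ size a → B
  ascend zero    a m<size = ⊥-elim (ℕ.<⇒≱ m<size (bounded a))
  ascend (suc k) a m<1+k+size with grow a
  ... | inj₁ b                 = b
  ... | inj₂ (a′ , size<size′) = ascend k a′ (begin-strict
    m                    <⟨ m<1+k+size ⟩
    suc k ℕ.+ size a     ≡⟨ ≡.sym (ℕ.+-suc k (size a)) ⟩
    k ℕ.+ suc (size a)   ≤⟨ ℕ.+-monoʳ-≤ k size<size′ ⟩
    k ℕ.+ size a′        ∎)
    where open ℕ.≤-Reasoning

NotHead : ∀ {n} → Fin n → List (Fin n) → Set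
NotHead c []      = ⊤
NotHead c (r ∷ _) = c ≢ r

notHead? : ∀ {n} c (L : List (Fin n)) → Dec (NotHead c L)
notHead? c []      = yes tt
notHead? c (r ∷ _) = ¬? (c ≟ r)

All≢⇒NotHead : ∀ {n} {c : Fin n} {L} → All (c ≢_) L → NotHead c L
All≢⇒NotHead []          = tt
All≢⇒NotHead (c≢r ∷ _)   = c≢r

dropHead : ∀ {n} → VSet n → List (Fin n) → VSet n
dropHead S []      = S
dropHead S (r ∷ _) = remove S r

∈-dropHead⁺ : ∀ {n} (S : VSet n) L {c} → In S c → NotHead c L → In (dropHead S L) c
∈-dropHead⁺ S []      c∈S _   = c∈S
∈-dropHead⁺ S (r ∷ _) c∈S c≢r = ∈-remove⁺ S c∈S c≢r

∈-dropHead⁻ : ∀ {n} (S : VSet n) L {c} → In (dropHead S L) c → In S c × NotHead c L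
∈-dropHead⁻ S []      c∈S = c∈S , tt
∈-dropHead⁻ S (r ∷ _) c∈  = ∈-remove⁻ S c∈

valueAtHead : ∀ {n} → (Fin n → ℤ) → List (Fin n) → ℤ
valueAtHead x []      = 0ℤ
valueAtHead x (r ∷ _) = x r

valueAtHead-sign : ∀ {n} {x : Fin n → ℤ} → SignVector x → ∀ L → valueAtHead x L ≡ 0ℤ ⊎ IsSign (valueAtHead x L)
valueAtHead-sign sign []      = inj₁ refl
valueAtHead-sign sign (r ∷ _) = inj₂ (sign r)

module _ {n : ℕ} (G : Graph n) where

  Adj-sym : ∀ {u v} → Adj G u v → Adj G v u
  Adj-sym {u} {v} u~v = trans (≡.sym (sym G u v)) u~v

  Adj⇒≢ : ∀ {u v} → Adj G u v → u ≢ v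
  Adj⇒≢ {u} u~u refl with () ← trans (≡.sym (irrefl G u)) u~u

  nbrs : VSet n → Fin n → VSet n
  nbrs S v z = S z ∧ adj G v z

  ∈-nbrs⁺ : ∀ S {v z} → In S z → Adj G v z → In (nbrs S v) z
  ∈-nbrs⁺ S = ∧-≡true⁺

  ∈-nbrs⁻ : ∀ S {v z} → In (nbrs S v) z → In S z × Adj G v z
  ∈-nbrs⁻ S {z = z} = ∧-≡true⁻ (S z)

  IsEigenvector₁On : VSet n → (Fin n → ℤ) → Set
  IsEigenvector₁On S x = ∀ v → In S v → sumOver (nbrs S v) x ≡ x v

  OnlyNeighbour : VSet n → Fin n → Fin n → Set
  OnlyNeighbour S c t = ∀ d → In S d → Adj G c d → d ≡ t

  leaf⇒onlyNeighbour : ∀ {S c t} → IsLeaf G S c → In S t → Adj G c t → OnlyNeighbour S c t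
  leaf⇒onlyNeighbour {t = t} (_ , _ , _ , _ , only) t∈S c~t d d∈S c~d = trans (only d d∈S c~d) (≡.sym (only t t∈S c~t))

  sumOver-nbrs-only : ∀ S g {c t} → In S t → Adj G c t → OnlyNeighbour S c t → sumOver (nbrs S c) g ≡ g t
  sumOver-nbrs-only S g t∈S c~t only =
    sumOver-singleton (nbrs S _) g (∈-nbrs⁺ S t∈S c~t) (λ z z∈N → let z∈S , c~z = ∈-nbrs⁻ S z∈N in only z z∈S c~z)

  onlyNeighbour-value : ∀ {S x c t} → IsEigenvector₁On S x → In S c → In S t → Adj G c t →
                        OnlyNeighbour S c t → x c ≡ x t
  onlyNeighbour-value {S} {x} eigen c∈S t∈S c~t only =
    trans (≡.sym (eigen _ c∈S)) (sumOver-nbrs-only S x t∈S c~t only)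

  data WalkIn (S : VSet n) : Fin n → Fin n → Set where
    here  : ∀ v → WalkIn S v v
    there : ∀ {u v w} → Adj G u v → In S v → WalkIn S v w → WalkIn S u w

  ConnectedOn : VSet n → Set
  ConnectedOn S = ∀ p q → In S p → In S q → WalkIn S p q

  module ReductionStep (S : VSet n) (a y u₀ u₁ w : Fin n)
    (a∈S : In S a) (y∈S : In S y)
    (u₀-leaf : IsLeaf G S u₀) (u₁-leaf : IsLeaf G S u₁) (w-leaf : IsLeaf G S w)
    (u₀≢u₁ : u₀ ≢ u₁) (u₀≢a : u₀ ≢ a) (u₁≢a : u₁ ≢ a)
    (y~u₀ : Adj G y u₀) (y~u₁ : Adj G y u₁) (y~a : Adj G y a)
    (y-nbrs : ∀ z → In S z → Adj G y z → z ≡ u₀ ⊎ z ≡ u₁ ⊎ z ≡ a)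
    (w~a : Adj G w a) where

    S′ : VSet n
    S′ = delete4 S y u₀ u₁ w

    Kept Removed : Fin n → Set
    Kept z = z ≢ u₀ × z ≢ u₁ × z ≢ y × z ≢ w
    Removed z = z ≡ u₀ ⊎ z ≡ u₁ ⊎ z ≡ y ⊎ z ≡ w

    -- S′ z unfolds to S z ∧ does (kept? z).
    kept? : ∀ z → Dec (Kept z)
    kept? z = ¬? (z ≟ u₀) ×-dec ¬? (z ≟ u₁) ×-dec ¬? (z ≟ y) ×-dec ¬? (z ≟ w)

    ∈S′⁺ : ∀ {z} → In S z → Kept z → In S′ z
    ∈S′⁺ {z} z∈S kept = ∧-≡true⁺ z∈S (dec-true (kept? z) kept)

    ∈S′⁻ : ∀ {z} → In S′ z → In S z × Kept z
    ∈S′⁻ {z} z∈S′ = let z∈S , is-kept = ∧-≡true⁻ (S z) z∈S′ in z∈S , does≡true⇒ (kept? z) is-kept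

    kept⊎removed : ∀ z → Kept z ⊎ Removed z
    kept⊎removed z with z ≟ u₀ | z ≟ u₁ | z ≟ y | z ≟ w
    ... | yes z≡u₀ | _        | _       | _       = inj₂ (inj₁ z≡u₀)
    ... | no z≢u₀  | yes z≡u₁ | _       | _       = inj₂ (inj₂ (inj₁ z≡u₁))
    ... | no z≢u₀  | no z≢u₁  | yes z≡y | _       = inj₂ (inj₂ (inj₂ (inj₁ z≡y)))
    ... | no z≢u₀  | no z≢u₁  | no z≢y  | yes z≡w = inj₂ (inj₂ (inj₂ (inj₂ z≡w)))
    ... | no z≢u₀  | no z≢u₁  | no z≢y  | no z≢w  = inj₁ (z≢u₀ , z≢u₁ , z≢y , z≢w)

    kept⇒¬removed : ∀ {z} → Kept z → ¬ Removed z
    kept⇒¬removed (z≢u₀ , _ , _ , _) (inj₁ z≡u₀)               = z≢u₀ z≡u₀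
    kept⇒¬removed (_ , z≢u₁ , _ , _) (inj₂ (inj₁ z≡u₁))        = z≢u₁ z≡u₁
    kept⇒¬removed (_ , _ , z≢y , _)  (inj₂ (inj₂ (inj₁ z≡y)))  = z≢y z≡y
    kept⇒¬removed (_ , _ , _ , z≢w)  (inj₂ (inj₂ (inj₂ z≡w)))  = z≢w z≡w

    u₀∈S : In S u₀
    u₀∈S = proj₁ u₀-leaf

    u₁∈S : In S u₁
    u₁∈S = proj₁ u₁-leaf

    w∈S : In S w
    w∈S = proj₁ w-leaf

    u₀-only : OnlyNeighbour S u₀ y
    u₀-only = leaf⇒onlyNeighbour u₀-leaf y∈S (Adj-sym y~u₀)

    u₁-only : OnlyNeighbour S u₁ y
    u₁-only = leaf⇒onlyNeighbour u₁-leaf y∈S (Adj-sym y~u₁)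

    w-only : OnlyNeighbour S w a
    w-only = leaf⇒onlyNeighbour w-leaf a∈S w~a

    y≢a : y ≢ a
    y≢a = Adj⇒≢ y~a

    y≢w : y ≢ w
    y≢w refl = u₀≢a (w-only u₀ u₀∈S y~u₀)

    w≢u₀ : w ≢ u₀
    w≢u₀ refl = y≢a (≡.sym (u₀-only a a∈S w~a))

    w≢u₁ : w ≢ u₁
    w≢u₁ refl = y≢a (≡.sym (u₁-only a a∈S w~a))

    a-kept : Kept a
    a-kept = ≢-sym u₀≢a , ≢-sym u₁≢a , ≢-sym y≢a , ≢-sym (Adj⇒≢ w~a)

    a∈S′ : In S′ a
    a∈S′ = ∈S′⁺ a∈S a-kept

    removed-nbr≡a : ∀ {z v} → Removed z → In S′ v → Adj G z v → v ≡ a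
    removed-nbr≡a {v = v} removed v∈S′ z~v with ∈S′⁻ v∈S′
    ... | v∈S , v≢u₀ , v≢u₁ , v≢y , _ = nbr removed
      where
      nbr : Removed _ → v ≡ a
      nbr (inj₁ refl)               = ⊥-elim (v≢y (u₀-only v v∈S z~v))
      nbr (inj₂ (inj₁ refl))        = ⊥-elim (v≢y (u₁-only v v∈S z~v))
      nbr (inj₂ (inj₂ (inj₂ refl))) = w-only v v∈S z~v
      nbr (inj₂ (inj₂ (inj₁ refl))) with y-nbrs v v∈S z~v
      ... | inj₁ v≡u₀        = ⊥-elim (v≢u₀ v≡u₀)
      ... | inj₂ (inj₁ v≡u₁) = ⊥-elim (v≢u₁ v≡u₁)
      ... | inj₂ (inj₂ v≡a)  = v≡a

    -- A walk in G[S] ending in G[S′] can leave S′ only through a.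
    restrict-walk : ∀ {v q} → In S′ q → WalkIn S v q →
                    (In S′ v → WalkIn S′ v q) × (Removed v → WalkIn S′ a q)
    restrict-walk q∈S′ (here _) =
      (λ _ → here _) , λ removed → ⊥-elim (kept⇒¬removed (proj₂ (∈S′⁻ q∈S′)) removed)
    restrict-walk q∈S′ (there {v = v} u~v v∈S walk) with restrict-walk q∈S′ walk | kept⊎removed v
    ... | from-v , _ | inj₁ v-kept =
      (λ _ → there u~v v∈S′ (from-v v∈S′)) ,
      (λ u-removed → subst (λ t → WalkIn S′ t _) (removed-nbr≡a u-removed v∈S′ u~v) (from-v v∈S′))
      where v∈S′ = ∈S′⁺ v∈S v-kept
    ... | _ , from-a | inj₂ v-removed =
      (λ u∈S′ → subst (λ t → WalkIn S′ t _) (≡.sym (removed-nbr≡a v-removed u∈S′ (Adj-sym u~v))) (from-a v-removed)) ,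
      (λ _ → from-a v-removed)

    restrict-connected : ConnectedOn S → ConnectedOn S′
    restrict-connected connected p q p∈S′ q∈S′ =
      proj₁ (restrict-walk q∈S′ (connected p q (proj₁ (∈S′⁻ p∈S′)) (proj₁ (∈S′⁻ q∈S′)))) p∈S′

    count-S′<count-S : count S′ < count S
    count-S′<count-S = begin-strict
      count S′                  ≤⟨ count-mono S′ (remove S y) S′⊆S-y ⟩
      count (remove S y)        <⟨ ℕ.n<1+n _ ⟩
      suc (count (remove S y))  ≡⟨ ≡.sym (count-remove S y∈S) ⟩
      count S                   ∎
      where
      open ℕ.≤-Reasoning
      S′⊆S-y : ∀ z → In S′ z → In (remove S y) z
      S′⊆S-y z z∈S′ = let z∈S , _ , _ , z≢y , _ = ∈S′⁻ z∈S′ in ∈-remove⁺ S z∈S z≢y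

    sumOver-nbrs-kept : ∀ {v} → In S′ v → v ≢ a → ∀ g g′ → (∀ z → In S′ z → g z ≡ g′ z) →
                        sumOver (nbrs S v) g ≡ sumOver (nbrs S′ v) g′
    sumOver-nbrs-kept {v} v∈S′ v≢a g g′ g≡g′ =
      sumOver-cong N⊆N′ (λ z z∈N′ → let z∈S′ , v~z = ∈-nbrs⁻ S′ z∈N′ in ∈-nbrs⁺ S (proj₁ (∈S′⁻ z∈S′)) v~z)
                   (λ z z∈N → g≡g′ z (proj₁ (∈-nbrs⁻ S′ (N⊆N′ z z∈N))))
      where
      N⊆N′ : ∀ z → In (nbrs S v) z → In (nbrs S′ v) z
      N⊆N′ z z∈N with ∈-nbrs⁻ S z∈N | kept⊎removed z
      ... | z∈S , v~z | inj₁ z-kept    = ∈-nbrs⁺ S′ (∈S′⁺ z∈S z-kept) v~z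
      ... | _   , v~z | inj₂ z-removed = ⊥-elim (v≢a (removed-nbr≡a z-removed v∈S′ (Adj-sym v~z)))

    sumOver-nbrs-a : ∀ g → sumOver (nbrs S a) g ≡ g y + (g w + sumOver (nbrs S′ a) g)
    sumOver-nbrs-a g = begin
      sumOver (nbrs S a) g                                   ≡⟨ sumOver-remove _ g y∈N ⟩
      g y + sumOver N-y g                                    ≡⟨ cong (λ t → g y + t) (sumOver-remove N-y g w∈N-y) ⟩
      g y + (g w + sumOver (remove N-y w) g)                 ≡⟨ cong (λ t → g y + (g w + t))
                                                                     (sumOver-cong ⊆N′ ⊇N′ (λ _ _ → refl)) ⟩
      g y + (g w + sumOver (nbrs S′ a) g)                    ∎
      where
      open ≡-Reasoning
      N-y = remove (nbrs S a) y
      y∈N = ∈-nbrs⁺ S y∈S (Adj-sym y~a)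
      w∈N-y = ∈-remove⁺ (nbrs S a) (∈-nbrs⁺ S w∈S (Adj-sym w~a)) (≢-sym y≢w)
      ⊆N′ : ∀ z → In (remove N-y w) z → In (nbrs S′ a) z
      ⊆N′ z z∈ with ∈-remove⁻ N-y z∈
      ... | z∈N-y , z≢w with ∈-remove⁻ (nbrs S a) z∈N-y
      ...   | z∈N , z≢y with ∈-nbrs⁻ S z∈N
      ...     | z∈S , a~z = ∈-nbrs⁺ S′ (∈S′⁺ z∈S (z≢u₀ , z≢u₁ , z≢y , z≢w)) a~z
        where
        z≢u₀ : z ≢ u₀
        z≢u₀ refl = y≢a (≡.sym (u₀-only a a∈S (Adj-sym a~z)))
        z≢u₁ : z ≢ u₁
        z≢u₁ refl = y≢a (≡.sym (u₁-only a a∈S (Adj-sym a~z)))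
      ⊇N′ : ∀ z → In (nbrs S′ a) z → In (remove N-y w) z
      ⊇N′ z z∈N′ with ∈-nbrs⁻ S′ z∈N′
      ... | z∈S′ , a~z with ∈S′⁻ z∈S′
      ...   | z∈S , _ , _ , z≢y , z≢w = ∈-remove⁺ N-y (∈-remove⁺ (nbrs S a) (∈-nbrs⁺ S z∈S a~z) z≢y) z≢w

    sumOver-nbrs-y : ∀ g → sumOver (nbrs S y) g ≡ g u₀ + (g u₁ + g a)
    sumOver-nbrs-y g =
      sumOver-three (nbrs S y) g (∈-nbrs⁺ S u₀∈S y~u₀) (∈-nbrs⁺ S u₁∈S y~u₁) (∈-nbrs⁺ S a∈S y~a)
        u₀≢u₁ u₀≢a u₁≢a (λ z z∈N → let z∈S , y~z = ∈-nbrs⁻ S z∈N in y-nbrs z z∈S y~z)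

    restrict-eigenvector : ∀ {x} → IsEigenvector₁On S x → IsEigenvector₁On S′ x
    restrict-eigenvector {x} eigen v v∈S′ with v ≟ a
    ... | no v≢a  = trans (≡.sym (sumOver-nbrs-kept v∈S′ v≢a x x (λ _ _ → refl))) (eigen v (proj₁ (∈S′⁻ v∈S′)))
    ... | yes refl = begin
      sumOver (nbrs S′ a) x                         ≡⟨ ≡.sym (\\-leftDividesʳ (x a) _) ⟩
      - x a + (x a + sumOver (nbrs S′ a) x)         ≡⟨ cong₂ (λ s t → s + (t + sumOver (nbrs S′ a) x))
                                                             (≡.sym xy≡-xa) (≡.sym xw≡xa) ⟩
      x y + (x w + sumOver (nbrs S′ a) x)           ≡⟨ ≡.sym (sumOver-nbrs-a x) ⟩
      sumOver (nbrs S a) x                          ≡⟨ eigen a a∈S ⟩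
      x a                                           ∎
      where
      open ≡-Reasoning
      xw≡xa : x w ≡ x a
      xw≡xa = onlyNeighbour-value eigen w∈S a∈S w~a w-only
      xy≡-xa : x y ≡ - x a
      xy≡-xa = t≡t+[t+s]⇒t≡-s (x y) (x a) (begin
        x y                    ≡⟨ ≡.sym (eigen y y∈S) ⟩
        sumOver (nbrs S y) x   ≡⟨ sumOver-nbrs-y x ⟩
        x u₀ + (x u₁ + x a)    ≡⟨ cong₂ (λ s t → s + (t + x a))
                                    (onlyNeighbour-value eigen u₀∈S y∈S (Adj-sym y~u₀) u₀-only)
                                    (onlyNeighbour-value eigen u₁∈S y∈S (Adj-sym y~u₁) u₁-only) ⟩
        x y + (x y + x a)      ∎)

    -- The values are forced: a leaf copies its neighbour, and the equation at y gives x y = - x a.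
    lift : (Fin n → ℤ) → Fin n → ℤ
    lift x z = if does (z ≟ w) then x a else if does (kept? z) then x z else - x a

    lift-w : ∀ x → lift x w ≡ x a
    lift-w x = cong (λ b → if b then x a else if does (kept? w) then x w else - x a) (dec-true (w ≟ w) refl)

    lift-kept : ∀ x {z} → Kept z → lift x z ≡ x z
    lift-kept x {z} kept@(_ , _ , _ , z≢w) =
      cong₂ (λ b c → if b then x a else if c then x z else - x a) (dec-false (z ≟ w) z≢w) (dec-true (kept? z) kept)

    lift-dropped : ∀ x {z} → z ≢ w → ¬ Kept z → lift x z ≡ - x a
    lift-dropped x {z} z≢w ¬kept =
      cong₂ (λ b c → if b then x a else if c then x z else - x a) (dec-false (z ≟ w) z≢w) (dec-false (kept? z) ¬kept)

    lift-sign : ∀ {x} → SignVector x → SignVector (lift x)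
    lift-sign {x} sign z =
      if-preserves {P = IsSign} (does (z ≟ w)) (sign a)
        (if-preserves {P = IsSign} (does (kept? z)) (sign z) (-‿sign (sign a)))

    lift-on-S′ : ∀ x z → In S′ z → lift x z ≡ x z
    lift-on-S′ x z z∈S′ = lift-kept x (proj₂ (∈S′⁻ z∈S′))

    lift-u₀ : ∀ x → lift x u₀ ≡ - x a
    lift-u₀ x = lift-dropped x (≢-sym w≢u₀) (λ (u₀≢u₀ , _) → u₀≢u₀ refl)

    lift-u₁ : ∀ x → lift x u₁ ≡ - x a
    lift-u₁ x = lift-dropped x (≢-sym w≢u₁) (λ (_ , u₁≢u₁ , _) → u₁≢u₁ refl)

    lift-y : ∀ x → lift x y ≡ - x a
    lift-y x = lift-dropped x y≢w (λ (_ , _ , y≢y , _) → y≢y refl)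

    lift-eigenvector : ∀ {x} → IsEigenvector₁On S′ x → IsEigenvector₁On S (lift x)
    lift-eigenvector {x} eigen v v∈S with kept⊎removed v
    ... | inj₁ v-kept with v ≟ a
    ...   | no v≢a = begin
      sumOver (nbrs S v) (lift x)   ≡⟨ sumOver-nbrs-kept (∈S′⁺ v∈S v-kept) v≢a (lift x) x (lift-on-S′ x) ⟩
      sumOver (nbrs S′ v) x         ≡⟨ eigen v (∈S′⁺ v∈S v-kept) ⟩
      x v                           ≡⟨ ≡.sym (lift-kept x v-kept) ⟩
      lift x v                      ∎
      where open ≡-Reasoning
    ...   | yes refl = begin
      sumOver (nbrs S a) (lift x)                         ≡⟨ sumOver-nbrs-a (lift x) ⟩
      lift x y + (lift x w + sumOver (nbrs S′ a) (lift x)) ≡⟨ cong₂ (λ s t → s + (t + sumOver (nbrs S′ a) (lift x)))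
                                                                  (lift-y x) (lift-w x) ⟩
      - x a + (x a + sumOver (nbrs S′ a) (lift x))        ≡⟨ \\-leftDividesʳ (x a) _ ⟩
      sumOver (nbrs S′ a) (lift x)                        ≡⟨ sumOver-cong (λ _ z∈ → z∈) (λ _ z∈ → z∈)
                                                                  (λ z z∈N → lift-on-S′ x z (proj₁ (∈-nbrs⁻ S′ z∈N))) ⟩
      sumOver (nbrs S′ a) x                               ≡⟨ eigen a a∈S′ ⟩
      x a                                                 ≡⟨ ≡.sym (lift-kept x a-kept) ⟩
      lift x a                                            ∎
      where open ≡-Reasoning
    lift-eigenvector {x} eigen v v∈S | inj₂ (inj₁ refl) =
      trans (sumOver-nbrs-only S (lift x) y∈S (Adj-sym y~u₀) u₀-only) (trans (lift-y x) (≡.sym (lift-u₀ x)))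
    lift-eigenvector {x} eigen v v∈S | inj₂ (inj₂ (inj₁ refl)) =
      trans (sumOver-nbrs-only S (lift x) y∈S (Adj-sym y~u₁) u₁-only) (trans (lift-y x) (≡.sym (lift-u₁ x)))
    lift-eigenvector {x} eigen v v∈S | inj₂ (inj₂ (inj₂ (inj₁ refl))) = begin
      sumOver (nbrs S y) (lift x)          ≡⟨ sumOver-nbrs-y (lift x) ⟩
      lift x u₀ + (lift x u₁ + lift x a)   ≡⟨ cong₂ (λ s t → s + (t + lift x a)) (lift-u₀ x) (lift-u₁ x) ⟩
      - x a + (- x a + lift x a)           ≡⟨ cong (λ t → - x a + (- x a + t)) (lift-kept x a-kept) ⟩
      - x a + (- x a + x a)                ≡⟨ cong (λ t → - x a + t) (ℤ.+-inverseˡ (x a)) ⟩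
      - x a + 0ℤ                           ≡⟨ ℤ.+-identityʳ _ ⟩
      - x a                                ≡⟨ ≡.sym (lift-y x) ⟩
      lift x y                             ∎
      where open ≡-Reasoning
    lift-eigenvector {x} eigen v v∈S | inj₂ (inj₂ (inj₂ (inj₂ refl))) =
      trans (sumOver-nbrs-only S (lift x) a∈S w~a w-only) (trans (lift-kept x a-kept) (≡.sym (lift-w x)))

  In? : ∀ (S : VSet n) v → Dec (In S v)
  In? S v = S v Bool.≟ true

  Adj? : ∀ u v → Dec (Adj G u v)
  Adj? u v = adj G u v Bool.≟ true

  HasReductionStep : VSet n → Set
  HasReductionStep S = Σ (Fin n) λ a → Σ (Fin n) λ y → Σ (Fin n) λ u₀ → Σ (Fin n) λ u₁ → Σ (Fin n) λ w →
                       IsReductionStep G S a y u₀ u₁ w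

  StarAt : VSet n → Fin n → Fin n → Set
  StarAt S v p = ∀ c → In S c → Adj G v c → c ≢ p → OnlyNeighbour S c v

  Branch : VSet n → Fin n → Fin n → Set
  Branch S v p = Σ (Fin n) λ c → Σ (Fin n) λ d →
                 In S c × Adj G v c × c ≢ p × In S d × Adj G c d × d ≢ v

  branch? : ∀ S v p → Dec (Branch S v p)
  branch? S v p = any? λ c → any? λ d →
    In? S c ×-dec Adj? v c ×-dec ¬? (c ≟ p) ×-dec In? S d ×-dec Adj? c d ×-dec ¬? (d ≟ v)

  ¬branch⇒star : ∀ {S v p} → ¬ Branch S v p → StarAt S v p
  ¬branch⇒star {v = v} ¬branch c c∈S v~c c≢p d d∈S c~d with d ≟ v
  ... | yes d≡v = d≡v
  ... | no d≢v  = ⊥-elim (¬branch (c , d , c∈S , v~c , c≢p , d∈S , c~d , d≢v))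

  star⇒leaf : ∀ {S v p c} → StarAt S v p → In S v → In S c → Adj G v c → c ≢ p → IsLeaf G S c
  star⇒leaf star v∈S c∈S v~c c≢p = c∈S , _ , v∈S , Adj-sym v~c , star _ c∈S v~c c≢p

  count≡0⇒leaf : ∀ {S c p} → In S c → In S p → Adj G c p → count (remove (nbrs S c) p) ≡ 0 → IsLeaf G S c
  count≡0⇒leaf {S} {c} {p} c∈S p∈S c~p count≡0 = c∈S , p , p∈S , c~p , only
    where
    only : OnlyNeighbour S c p
    only d d∈S c~d with d ≟ p
    ... | yes d≡p = d≡p
    ... | no d≢p with () ← trans (≡.sym (count≡0⇒empty _ count≡0 d)) (∈-remove⁺ (nbrs S c) (∈-nbrs⁺ S d∈S c~d) d≢p)

  sumOver-nbrs-dropHead : ∀ S g {v L} → Linked (Adj G) (v ∷ L) → All (In S) L →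
                          sumOver (nbrs S v) g ≡ valueAtHead g L + sumOver (dropHead (nbrs S v) L) g
  sumOver-nbrs-dropHead S g [-]         []        = ≡.sym (ℤ.+-identityˡ _)
  sumOver-nbrs-dropHead S g (v~r ∷ _)   (r∈S ∷ _) = sumOver-remove (nbrs S _) g (∈-nbrs⁺ S r∈S v~r)

  Cherry : VSet n → Set
  Cherry S = Σ (Fin n) λ t → Σ (Fin n) λ s₁ → Σ (Fin n) λ s₂ →
             In S t × In S s₁ × In S s₂ × Adj G t s₁ × Adj G t s₂ × s₁ ≢ s₂

  cherry? : ∀ S → Dec (Cherry S)
  cherry? S = any? λ t → any? λ s₁ → any? λ s₂ →
    In? S t ×-dec In? S s₁ ×-dec In? S s₂ ×-dec Adj? t s₁ ×-dec Adj? t s₂ ×-dec ¬? (s₁ ≟ s₂)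

  ¬cherry⇒K2 : ∀ {S v p} → ¬ Cherry S → ConnectedOn S → In S v → In S p → Adj G v p → IsK2 G S
  ¬cherry⇒K2 {S} {v} {p} ¬cherry connected v∈S p∈S v~p =
    v , p , v∈S , p∈S , v~p , λ z z∈S → stays (connected v z v∈S z∈S) (inj₁ refl) v∈S
    where
    same : ∀ {t s₁ s₂} → In S t → In S s₁ → In S s₂ → Adj G t s₁ → Adj G t s₂ → s₁ ≡ s₂
    same {t} {s₁} {s₂} t∈S s₁∈S s₂∈S t~s₁ t~s₂ with s₁ ≟ s₂
    ... | yes s₁≡s₂ = s₁≡s₂
    ... | no s₁≢s₂  = ⊥-elim (¬cherry (t , s₁ , s₂ , t∈S , s₁∈S , s₂∈S , t~s₁ , t~s₂ , s₁≢s₂))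
    stays : ∀ {u z} → WalkIn S u z → u ≡ v ⊎ u ≡ p → In S u → z ≡ v ⊎ z ≡ p
    stays (here _)               u∈vp        _   = u∈vp
    stays (there u~t t∈S walk) (inj₁ refl) u∈S = stays walk (inj₂ (same u∈S t∈S p∈S u~t v~p)) t∈S
    stays (there u~t t∈S walk) (inj₂ refl) u∈S = stays walk (inj₁ (same u∈S t∈S v∈S u~t (Adj-sym v~p))) t∈S

  module _ {x : Fin n → ℤ} (sign : SignVector x) {S : VSet n} (eigen : IsEigenvector₁On S x) where

    has-neighbour : ∀ {v} → In S v → ∃ λ p → In S p × Adj G v p
    has-neighbour {v} v∈S with count (nbrs S v) ℕ.≟ 0
    ... | yes count≡0 = ⊥-elim (sign≢0 (sign v)
            (trans (≡.sym (eigen v v∈S)) (sumOver-empty _ x (count≡0⇒empty _ count≡0))))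
    ... | no count≢0 = let p , p∈N = count≢0⇒nonempty _ count≢0 in p , ∈-nbrs⁻ S p∈N

    -- The k leaves at v carry x v, so x v = x p + k x v; signs force k ∈ {0, 2}.
    star-degree : ∀ {v p} → In S v → In S p → Adj G v p → StarAt S v p →
                  count (remove (nbrs S v) p) ≡ 0 ⊎ (count (remove (nbrs S v) p) ≡ 2 × x v ≡ - x p)
    star-degree {v} {p} v∈S p∈S v~p star = sign-star _ (sign v) (sign p) (begin
      x v                                         ≡⟨ ≡.sym (eigen v v∈S) ⟩
      sumOver (nbrs S v) x                        ≡⟨ sumOver-remove _ x (∈-nbrs⁺ S p∈S v~p) ⟩
      x p + sumOver Leaves x                      ≡⟨ cong (λ t → x p + t) (sumOver-const Leaves x (x v) leaf-value) ⟩
      x p + + count Leaves * x v                  ∎)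
      where
      open ≡-Reasoning
      Leaves = remove (nbrs S v) p
      leaf-value : ∀ c → In Leaves c → x c ≡ x v
      leaf-value c c∈ = let c∈N , c≢p = ∈-remove⁻ (nbrs S v) c∈ ; c∈S , v~c = ∈-nbrs⁻ S c∈N in
        onlyNeighbour-value eigen c∈S v∈S (Adj-sym v~c) (star c c∈S v~c c≢p)

    leaf-neighbour : ∀ {v u L} → In S v → In S u → Adj G v u → NotHead u L →
                     Linked (Adj G) (v ∷ L) → All (In S) L →
                     (∀ c → In S c → Adj G v c → NotHead c L → StarAt S c v) →
                     ∃ λ w → IsLeaf G S w × Adj G w v
    leaf-neighbour {v} {u} {L} v∈S u∈S v~u u≢head linked L⊆S stars
      with any? (λ c → In? (dropHead (nbrs S v) L) c ×-dec (count (remove (nbrs S c) v) ℕ.≟ 0))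
    ... | yes (w , w∈ , count≡0) =
      let w∈N , _ = ∈-dropHead⁻ (nbrs S v) L w∈ ; w∈S , v~w = ∈-nbrs⁻ S w∈N in
      w , count≡0⇒leaf w∈S v∈S (Adj-sym v~w) count≡0 , Adj-sym v~w
    ... | no ¬leaf = ⊥-elim (sign≢r+multiple k (sign v) (valueAtHead-sign sign L) (begin
      x v                                           ≡⟨ ≡.sym (eigen v v∈S) ⟩
      sumOver (nbrs S v) x                          ≡⟨ sumOver-nbrs-dropHead S x linked L⊆S ⟩
      valueAtHead x L + sumOver Others x            ≡⟨ cong (λ t → valueAtHead x L + t) (sumOver-const Others x (- x v) centre-value) ⟩
      valueAtHead x L + + count Others * - x v      ≡⟨ cong (λ m → valueAtHead x L + + m * - x v) (count-remove Others u∈Others) ⟩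
      valueAtHead x L + + suc k * - x v             ∎))
      where
      open ≡-Reasoning
      Others = dropHead (nbrs S v) L
      u∈Others = ∈-dropHead⁺ (nbrs S v) L (∈-nbrs⁺ S u∈S v~u) u≢head
      k = count (remove Others u)
      centre-value : ∀ c → In Others c → x c ≡ - x v
      centre-value c c∈ with ∈-dropHead⁻ (nbrs S v) L c∈
      ... | c∈N , c≢head with ∈-nbrs⁻ S c∈N
      ... | c∈S , v~c with star-degree c∈S v∈S (Adj-sym v~c) (stars c c∈S v~c c≢head)
      ... | inj₁ count≡0 = ⊥-elim (¬leaf (c , c∈ , count≡0))
      ... | inj₂ (_ , xc≡-xv) = xc≡-xv

  IsPathIn : VSet n → List (Fin n) → Set
  IsPathIn S vs = All (In S) vs × Linked (Adj G) vs × Unique vs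

  path-tail : ∀ {S v L} → IsPathIn S (v ∷ L) → IsPathIn S L
  path-tail (_ ∷ L⊆S , linked , _ ∷ unique) = L⊆S , Linked.tail linked , unique

  record Path (S : VSet n) : Set where
    constructor path
    field
      v₀ v₁ v₂ : Fin n
      rest     : List (Fin n)
      isPath   : IsPathIn S (v₀ ∷ v₁ ∷ v₂ ∷ rest)

  module _ (acyclic : ¬ HasCycle G) where

    -- Otherwise c, t and the path segment up to c would form a cycle.
    ∉-path : ∀ {c t L} → Linked (Adj G) (t ∷ L) → Unique (t ∷ L) → Adj G c t → NotHead c L → c ∉ t ∷ L
    ∉-path _ _ c~t _ (here c≡t) = Adj⇒≢ c~t c≡t
    ∉-path {L = m ∷ L} _ _ _ c≢m (there (here c≡m)) = c≢m c≡m
    ∉-path {c} {t} {m ∷ L} linked unique c~t _ (there (there c∈L)) with mid , zs , refl ← ∈-∃++ c∈L =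
      acyclic (t , c , m ∷ mid , s≤s z≤n ,
               Linked-++⁻ˡ (t ∷ m ∷ mid ∷ʳ c) (reassoc {Linked (Adj G)} linked) ,
               AllPairs-++⁻ˡ (t ∷ m ∷ mid ∷ʳ c) (reassoc {Unique} unique) , c~t)
      where
      reassoc : ∀ {P : List (Fin n) → Set} → P (t ∷ m ∷ mid ++ c ∷ zs) → P ((t ∷ m ∷ mid ∷ʳ c) ++ zs)
      reassoc {P} = subst (λ l → P (t ∷ m ∷ l)) (≡.sym (++-assoc mid [ c ] zs))

    path-cons : ∀ {S c t L} → IsPathIn S (t ∷ L) → In S c → Adj G t c → NotHead c L → IsPathIn S (c ∷ t ∷ L)
    path-cons {L = L} (L⊆S , linked , unique) c∈S t~c c∉next =
      c∈S ∷ L⊆S , Adj-sym t~c ∷ linked , ¬Any⇒All¬ _ (∉-path linked unique (Adj-sym t~c) c∉next) ∷ unique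

    module _ {x : Fin n → ℤ} (sign : SignVector x) {S : VSet n} (eigen : IsEigenvector₁On S x) where

      path-end-step : (P : Path S) → StarAt S (Path.v₁ P) (Path.v₂ P) →
                      (∀ c → In S c → Adj G (Path.v₂ P) c → NotHead c (Path.rest P) → StarAt S c (Path.v₂ P)) →
                      HasReductionStep S
      path-end-step (path v₀ v₁ v₂ rest (v₀∈S ∷ v₁∈S ∷ v₂∈S ∷ rest⊆S , v₀~v₁ ∷ v₁~v₂ ∷ linked ,
                                         (_ ∷ v₀≢v₂ ∷ _) ∷ (_ ∷ v₁∉rest) ∷ _)) star₁ stars₂ =
        two-leaves (star-degree sign eigen v₁∈S v₂∈S v₁~v₂ star₁)
        where
        Leaves = remove (nbrs S v₁) v₂
        v₀∈Leaves : In Leaves v₀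
        v₀∈Leaves = ∈-remove⁺ (nbrs S v₁) (∈-nbrs⁺ S v₀∈S (Adj-sym v₀~v₁)) v₀≢v₂
        w-leaf = leaf-neighbour sign eigen v₂∈S v₁∈S (Adj-sym v₁~v₂) (All≢⇒NotHead v₁∉rest) linked rest⊆S stars₂
        two-leaves : count Leaves ≡ 0 ⊎ (count Leaves ≡ 2 × x v₁ ≡ - x v₂) → HasReductionStep S
        two-leaves (inj₁ count≡0) with () ← trans (≡.sym count≡0) (count-remove Leaves {v₀} v₀∈Leaves)
        two-leaves (inj₂ (count≡2 , _)) with u , u∈Leaves , u≢v₀ , v₀-or-u ← count≡2⇒pair Leaves count≡2 v₀∈Leaves =
          v₂ , v₁ , v₀ , u , proj₁ w-leaf , v₂∈S , v₁∈S ,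
          star⇒leaf star₁ v₁∈S v₀∈S (Adj-sym v₀~v₁) v₀≢v₂ , star⇒leaf star₁ v₁∈S u∈S v₁~u u≢v₂ ,
          proj₁ (proj₂ w-leaf) ,
          ≢-sym u≢v₀ , v₀≢v₂ , u≢v₂ , Adj-sym v₀~v₁ , v₁~u , v₁~v₂ , v₁-nbrs , proj₂ (proj₂ w-leaf)
          where
          u∈N = proj₁ (∈-remove⁻ (nbrs S v₁) u∈Leaves)
          u∈S = proj₁ (∈-nbrs⁻ S u∈N)
          v₁~u = proj₂ (∈-nbrs⁻ S u∈N)
          u≢v₂ = proj₂ (∈-remove⁻ (nbrs S v₁) u∈Leaves)
          v₁-nbrs : ∀ z → In S z → Adj G v₁ z → z ≡ v₀ ⊎ z ≡ u ⊎ z ≡ v₂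
          v₁-nbrs z z∈S v₁~z with z ≟ v₂
          ... | yes z≡v₂ = inj₂ (inj₂ z≡v₂)
          ... | no z≢v₂ with v₀-or-u z (∈-remove⁺ (nbrs S v₁) (∈-nbrs⁺ S z∈S v₁~z) z≢v₂)
          ...   | inj₁ z≡v₀ = inj₁ z≡v₀
          ...   | inj₂ z≡u  = inj₂ (inj₁ z≡u)

      grow : (P : Path S) → HasReductionStep S ⊎ Σ (Path S) λ P′ → length (Path.rest P) < length (Path.rest P′)
      grow P@(path v₀ v₁ v₂ rest isPath) with branch? S v₁ v₂
      ... | yes (c , d , c∈S , v₁~c , c≢v₂ , d∈S , c~d , d≢v₁) =
        inj₂ (path d c v₁ (v₂ ∷ rest) (path-cons (path-cons (path-tail isPath) c∈S v₁~c c≢v₂) d∈S c~d d≢v₁) ,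
              ℕ.n<1+n _)
      ... | no ¬branch₁ with any? (λ c → In? S c ×-dec Adj? v₂ c ×-dec notHead? c rest ×-dec branch? S c v₂)
      ...   | yes (c , c∈S , v₂~c , c∉next , d , e , d∈S , c~d , d≢v₂ , e∈S , d~e , e≢c) =
        inj₂ (path e d c (v₂ ∷ rest)
                (path-cons (path-cons (path-cons (path-tail (path-tail isPath)) c∈S v₂~c c∉next)
                                      d∈S c~d d≢v₂)
                           e∈S d~e e≢c) ,
              ℕ.n<1+n _)
      ...   | no ¬branch₂ = inj₁ (path-end-step P (¬branch⇒star ¬branch₁)
                (λ c c∈S v₂~c c∉next → ¬branch⇒star (λ branch → ¬branch₂ (c , c∈S , v₂~c , c∉next , branch))))

      path-length≤ : (P : Path S) → length (Path.rest P) ≤ n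
      path-length≤ P = ℕ.m+n≤o⇒n≤o 3 (Unique⇒length≤ (proj₂ (proj₂ (Path.isPath P))))

      reductionStep⊎K2 : ConnectedOn S → ∃ (In S) → HasReductionStep S ⊎ IsK2 G S
      reductionStep⊎K2 connected (v , v∈S) with cherry? S
      ... | yes (t , s₁ , s₂ , t∈S , s₁∈S , s₂∈S , t~s₁ , t~s₂ , s₁≢s₂) =
        inj₁ (bounded-ascent (λ P → length (Path.rest P)) n path-length≤ grow
               (path s₁ t s₂ [] (s₁∈S ∷ t∈S ∷ s₂∈S ∷ [] , Adj-sym t~s₁ ∷ t~s₂ ∷ [-] ,
                                 (Adj⇒≢ (Adj-sym t~s₁) ∷ s₁≢s₂ ∷ []) ∷ (Adj⇒≢ t~s₂ ∷ []) ∷ [] ∷ [])))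
      ... | no ¬cherry = let p , p∈S , v~p = has-neighbour sign eigen v∈S in
        inj₂ (¬cherry⇒K2 ¬cherry connected v∈S p∈S v~p)

    reduces-to-K2 : ∀ {x} → SignVector x → ∀ k S → count S < k → IsEigenvector₁On S x → ConnectedOn S → ∃ (In S) →
                    ReducesToK2 G S
    reduces-to-K2 sign (suc k) S count<k eigen connected nonempty with reductionStep⊎K2 sign eigen connected nonempty
    ... | inj₂ K2 = done K2
    ... | inj₁ (a , y , u₀ , u₁ , w ,
                R@(a∈S , y∈S , u₀-leaf , u₁-leaf , w-leaf , u₀≢u₁ , u₀≢a , u₁≢a , y~u₀ , y~u₁ , y~a , y-nbrs , w~a)) =
      step a y u₀ u₁ w R (reduces-to-K2 sign k S′ (ℕ.<-≤-trans count-S′<count-S (ℕ.≤-pred count<k))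
                            (restrict-eigenvector eigen) (restrict-connected connected) (a , a∈S′))
      where open ReductionStep S a y u₀ u₁ w a∈S y∈S u₀-leaf u₁-leaf w-leaf u₀≢u₁ u₀≢a u₁≢a y~u₀ y~u₁ y~a y-nbrs w~a

  K2-eigenvector : ∀ {S} → IsK2 G S → IsEigenvector₁On S (λ _ → 1ℤ)
  K2-eigenvector {S} (p , q , p∈S , q∈S , p~q , p-or-q) v v∈S with p-or-q v v∈S
  ... | inj₁ refl = sumOver-nbrs-only S _ q∈S p~q only-q
    where
    only-q : OnlyNeighbour S p q
    only-q d d∈S p~d with p-or-q d d∈S
    ... | inj₁ refl = ⊥-elim (Adj⇒≢ p~d refl)
    ... | inj₂ d≡q  = d≡q
  ... | inj₂ refl = sumOver-nbrs-only S _ p∈S (Adj-sym p~q) only-p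
    where
    only-p : OnlyNeighbour S q p
    only-p d d∈S q~d with p-or-q d d∈S
    ... | inj₁ d≡p  = d≡p
    ... | inj₂ refl = ⊥-elim (Adj⇒≢ q~d refl)

  reducible⇒eigenvector : ∀ {S} → ReducesToK2 G S → Σ (Fin n → ℤ) λ x → SignVector x × IsEigenvector₁On S x
  reducible⇒eigenvector (done K2) = (λ _ → 1ℤ) , (λ _ → inj₁ refl) , K2-eigenvector K2
  reducible⇒eigenvector {S} (step a y u₀ u₁ w
      (a∈S , y∈S , u₀-leaf , u₁-leaf , w-leaf , u₀≢u₁ , u₀≢a , u₁≢a , y~u₀ , y~u₁ , y~a , y-nbrs , w~a) reduces)
    with x , sign , eigen ← reducible⇒eigenvector reduces =
      lift x , lift-sign sign , lift-eigenvector eigen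
    where open ReductionStep S a y u₀ u₁ w a∈S y∈S u₀-leaf u₁-leaf w-leaf u₀≢u₁ u₀≢a u₁≢a y~u₀ y~u₁ y~a y-nbrs w~a

  mulVec≡sumOver : ∀ x v → mulVec (adjMatrix G) x v ≡ sumOver (nbrs allV v) x
  mulVec≡sumOver x v = sumFin-cong entry
    where
    entry : ∀ j → adjMatrix G v j * x j ≡ (if adj G v j then x j else 0ℤ)
    entry j with adj G v j
    ... | true  = ℤ.*-identityˡ (x j)
    ... | false = refl

  walk⇒walkIn : ∀ {u v} → Walk G u v → WalkIn allV u v
  walk⇒walkIn (here v)       = here v
  walk⇒walkIn (there u~v walk) = there u~v refl (walk⇒walkIn walk)

mainTheorem4 : ∀ {n} (T : Graph n) → IsTree T →
    (Σ (Fin n → ℤ) (λ x → SignVector x × IsEigenvector T 1ℤ x)) ⇔ ReducesToK2 T allV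
mainTheorem4 {n} T (v , connected , acyclic) = mk⇔ to from
  where
  to : Σ (Fin n → ℤ) (λ x → SignVector x × IsEigenvector T 1ℤ x) → ReducesToK2 T allV
  to (x , sign , _ , Ax≡x) =
    reduces-to-K2 T acyclic sign (suc n) allV (s≤s (count≤n allV))
      (λ u _ → trans (≡.sym (mulVec≡sumOver T x u)) (trans (Ax≡x u) (ℤ.*-identityˡ (x u))))
      (λ p q _ _ → walk⇒walkIn T (connected p q)) (v , refl)
  from : ReducesToK2 T allV → Σ (Fin n → ℤ) (λ x → SignVector x × IsEigenvector T 1ℤ x)
  from reduces with x , sign , eigen ← reducible⇒eigenvector T reduces =
    x , sign , (v , sign≢0 (sign v)) ,
    λ u → trans (mulVec≡sumOver T x u) (trans (eigen u refl) (≡.sym (ℤ.*-identityˡ (x u))))
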